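{- Let $(V,E)$ be a connected interval graph with representation $(L,<_L,f_L,f_R)$, and let $v,u\in V$ with $\neg\,v\,E\,u$ and $F(v)<_L F(u)$. Let $w\in B(v,u)$. If $F(w)\nless_L F(u)$, then there exists a path $u\,E\,b_1\,E\cdots E\,b_k\,E\,w$ such that $e_{b_i}<e_w$ for all $i\le k$. Analogously, if $F(v)\nless_L F(w)$, then there exists a path $v\,E\,b_1\,E\cdots E\,b_k\,E\,w$ with $e_{b_i}<e_w$ for all $i\le k$.
   Context: An interval graph with representation $(L,<_L,f_L,f_R)$ is a reflexive graph $(V,E)$ ($E$ symmetric) with a linear order $(L,<_L)$ and maps $f_L,f_R\colon V\to L$, $f_L(x)\le_L f_R(x)$, such that with $F(x)=\{\ell\mid f_L(x)\le_L\ell\le_L f_R(x)\}$, $x\,E\,y\iff F(x)\cap F(y)\neq\emptyset$. $F(x)<_L F(y)$ means $f_R(x)<_L f_L(y)$ and $F(x)\nless_L F(y)$ is its negation. Connected means any two vertices are joined by a path. For $v,u$ with $\neg\,v\,E\,u$: $B_0(v,u)=\{v,u\}$, $B_{n+1}(v,u)=\{x\in V\mid\exists z,z'\in B_n(v,u)\,(z\,E\,x\wedge\neg\,z'\,E\,x)\}$, $B(v,u)=\bigcup_n B_n(v,u)$, and for $x\in B(v,u)$, $e_x$ is the least $n$ with $x\in B_n(v,u)$. -}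

module Defs where

open import Data.Nat using (ℕ; zero; suc)
open import Data.List using (List; []; _∷_)
open import Data.Product using (Σ; ∃; _×_; _,_)
open import Data.Sum using (_⊎_)
open import Relation.Nullary using (¬_)
open import Relation.Binary.PropositionalEquality using (_≡_)
open import Relation.Binary.Structures using (IsStrictTotalOrder)

record IntervalGraph : Set₁ where
  field
    V    : Set
    E    : V → V → Set
    E-refl : ∀ x → E x x
    E-sym  : ∀ {x y} → E x y → E y x
    L    : Set
    _<L_ : L → L → Set
    <L-isStrictTotalOrder : IsStrictTotalOrder _≡_ _<L_
    fL fR : V → L

  _≤L_ : L → L → Set
  a ≤L b = a <L b ⊎ a ≡ b

  _∈F_ : L → V → Set
  ℓ ∈F x = fL x ≤L ℓ × ℓ ≤L fR x

  field
    fL≤fR : ∀ x → fL x ≤L fR x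
    E-iff-meet : ∀ x y → (E x y → ∃ λ ℓ → ℓ ∈F x × ℓ ∈F y)
                        × ((∃ λ ℓ → ℓ ∈F x × ℓ ∈F y) → E x y)

  _F<_ : V → V → Set
  x F< y = fR x <L fL y

  -- Walk x bs y : x E b₁ E ⋯ E bₖ E y, where bs = b₁ ∷ ⋯ ∷ bₖ (k ≥ 0)
  data Walk : V → List V → V → Set where
    edge : ∀ {x y} → E x y → Walk x [] y
    step : ∀ {x b bs y} → E x b → Walk b bs y → Walk x (b ∷ bs) y

  Connected : Set
  Connected = ∀ x y → ∃ λ bs → Walk x bs y

  B : V → V → ℕ → V → Set
  B v u zero    x = x ≡ v ⊎ x ≡ u
  B v u (suc n) x = ∃ λ z → ∃ λ z' → B v u n z × B v u n z' × E z x × ¬ E z' x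

  IsE : V → V → V → ℕ → Set
  IsE v u x n = B v u n x × (∀ m → m Data.Nat.< n → ¬ B v u m x)

  E<  : V → V → V → ℕ → Set
  E< v u x n = ∃ λ m → m Data.Nat.< n × B v u m x

-- Take w ∈ B_k(v,u) with F(w) reaching at least fL(u). If F(w) also starts at
-- or before fL(u), the point fL(u) lies in F(w) and u E w. Otherwise w has a
-- neighbour z ∈ B_{k-1}(v,u), and F(z), which meets F(w), still reaches beyond
-- fL(u); induction on k gives a walk from u to z through vertices of smaller
-- index, which we extend by z. The case of v is the mirror image.
module Submission where

open import Defs
open import Data.Nat using (ℕ; zero; suc)
open import Data.Nat.Properties using (≤-refl; m<n⇒m<1+n)
open import Data.List using (List; []; _∷ʳ_)
open import Data.List.Relation.Unary.All using (All; [])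
import Data.List.Relation.Unary.All as All
open import Data.List.Relation.Unary.All.Properties using (∷ʳ⁺)
open import Data.Product using (∃; _×_; _,_; proj₁; proj₂)
open import Data.Sum using (_⊎_; inj₁; inj₂)
open import Data.Empty using (⊥-elim)
open import Relation.Nullary using (¬_)
open import Relation.Binary.PropositionalEquality using (refl; sym)
open import Relation.Binary.Definitions using (tri<; tri≈; tri>)
open import Relation.Binary.Structures using (IsStrictTotalOrder)

module _ (G : IntervalGraph) where
  open IntervalGraph G
  private module <L = IsStrictTotalOrder <L-isStrictTotalOrder

  ≤L-refl : ∀ {a} → a ≤L a
  ≤L-refl = inj₂ refl

  ≤L-trans : ∀ {a b c} → a ≤L b → b ≤L c → a ≤L c
  ≤L-trans (inj₁ a<b) (inj₁ b<c) = inj₁ (<L.trans a<b b<c)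
  ≤L-trans a≤b        (inj₂ refl) = a≤b
  ≤L-trans (inj₂ refl) b≤c        = b≤c

  <L-≤L-trans : ∀ {a b c} → a <L b → b ≤L c → a <L c
  <L-≤L-trans a<b (inj₁ b<c) = <L.trans a<b b<c
  <L-≤L-trans a<b (inj₂ refl) = a<b

  ≤L-<L-trans : ∀ {a b c} → a ≤L b → b <L c → a <L c
  ≤L-<L-trans (inj₁ a<b) b<c = <L.trans a<b b<c
  ≤L-<L-trans (inj₂ refl) b<c = b<c

  ≮L⇒≥L : ∀ {a b} → ¬ a <L b → b ≤L a
  ≮L⇒≥L {a} {b} a≮b with <L.compare a b
  ... | tri< a<b _ _ = ⊥-elim (a≮b a<b)
  ... | tri≈ _ a≡b _ = inj₂ (sym a≡b)
  ... | tri> _ _ b<a = inj₁ b<a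

  E⇒fL≤fR : ∀ {x y} → E x y → fL x ≤L fR y
  E⇒fL≤fR {x} {y} xEy with proj₁ (E-iff-meet x y) xEy
  ... | ℓ , (fLx≤ℓ , _) , (_ , ℓ≤fRy) = ≤L-trans fLx≤ℓ ℓ≤fRy

  ∈F⇒E : ∀ {ℓ x y} → ℓ ∈F x → ℓ ∈F y → E x y
  ∈F⇒E {ℓ} {x} {y} ℓ∈x ℓ∈y = proj₂ (E-iff-meet x y) (ℓ , ℓ∈x , ℓ∈y)

  ≮F⇒E⊎neighbours-≮F : ∀ {u w} → ¬ w F< u → E u w ⊎ (∀ {z} → E z w → ¬ z F< u)
  ≮F⇒E⊎neighbours-≮F {u} {w} w≮u with <L.compare (fL u) (fL w)
  ... | tri< fLu<fLw _ _ =
    inj₂ λ zEw z<u → <L.asym z<u (<L-≤L-trans fLu<fLw (E⇒fL≤fR (E-sym zEw)))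
  ... | tri≈ _ fLu≡fLw _ = inj₁ (∈F⇒E (≤L-refl , fL≤fR u) (inj₂ (sym fLu≡fLw) , ≮L⇒≥L w≮u))
  ... | tri> _ _ fLw<fLu = inj₁ (∈F⇒E (≤L-refl , fL≤fR u) (inj₁ fLw<fLu , ≮L⇒≥L w≮u))

  ≯F⇒E⊎neighbours-≯F : ∀ {v w} → ¬ v F< w → E v w ⊎ (∀ {z} → E z w → ¬ v F< z)
  ≯F⇒E⊎neighbours-≯F {v} {w} v≮w with <L.compare (fR w) (fR v)
  ... | tri< fRw<fRv _ _ =
    inj₂ λ zEw v<z → <L.asym v<z (≤L-<L-trans (E⇒fL≤fR zEw) fRw<fRv)
  ... | tri≈ _ fRw≡fRv _ = inj₁ (∈F⇒E (fL≤fR v , ≤L-refl) (≮L⇒≥L v≮w , inj₂ (sym fRw≡fRv)))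
  ... | tri> _ _ fRv<fRw = inj₁ (∈F⇒E (fL≤fR v , ≤L-refl) (≮L⇒≥L v≮w , inj₁ fRv<fRw))

  walk-∷ʳ : ∀ {x bs y w} → Walk x bs y → E y w → Walk x (bs ∷ʳ y) w
  walk-∷ʳ (edge xEy)    yEw = step xEy (edge yEw)
  walk-∷ʳ (step xEb bw) yEw = step xEb (walk-∷ʳ bw yEw)

  module _ (v u : V) where

    E<-suc : ∀ {b m} → E< v u b m → E< v u b (suc m)
    E<-suc (k , k<m , b∈Bk) = k , m<n⇒m<1+n k<m , b∈Bk

    -- The two halves of the theorem are the instances s = u, P x = ¬ x F< u
    -- and s = v, P x = ¬ v F< x.
    walk-from-B : (s : V) (P : V → Set) →
      (∀ {x} → B v u zero x → P x → E s x) →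
      (∀ {w} → P w → E s w ⊎ (∀ {z} → E z w → P z)) →
      ∀ k w → B v u k w → P w →
      ∃ λ (bs : List V) → Walk s bs w × All (λ b → E< v u b k) bs
    walk-from-B s P base closed zero w w∈B₀ Pw = [] , edge (base w∈B₀ Pw) , []
    walk-from-B s P base closed (suc m) w (z , _ , z∈Bm , _ , zEw , _) Pw
      with closed Pw
    ... | inj₁ sEw = [] , edge sEw , []
    ... | inj₂ inherit =
      let bs , s→z , bs<m = walk-from-B s P base closed m z z∈Bm (inherit zEw)
      in bs ∷ʳ z , walk-∷ʳ s→z zEw , ∷ʳ⁺ (All.map E<-suc bs<m) (m , ≤-refl , z∈Bm)

proposition3p9 : (G : IntervalGraph) → let open IntervalGraph G in
    Connected →
    (v u : V) → ¬ E v u → v F< u →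
    (w : V) (n : ℕ) → IsE v u w n →
    ((¬ (w F< u) → ∃ λ (bs : List V) → Walk u bs w × All (λ b → E< v u b n) bs)
    × (¬ (v F< w) → ∃ λ (bs : List V) → Walk v bs w × All (λ b → E< v u b n) bs))
proposition3p9 G _ v u _ v<u w n (w∈Bn , _) =
  walk-from-B G v u u (λ x → ¬ x F< u) from-u (≮F⇒E⊎neighbours-≮F G) n w w∈Bn ,
  walk-from-B G v u v (λ x → ¬ v F< x) from-v (≯F⇒E⊎neighbours-≯F G) n w w∈Bn
  where
  open IntervalGraph G
  from-u : ∀ {x} → B v u zero x → ¬ x F< u → E u x
  from-u (inj₁ refl) v≮u = ⊥-elim (v≮u v<u)
  from-u (inj₂ refl) _   = E-refl u
  from-v : ∀ {x} → B v u zero x → ¬ v F< x → E v x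
  from-v (inj₁ refl) _   = E-refl v
  from-v (inj₂ refl) v≮u = ⊥-elim (v≮u v<u)
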